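{- Let $T$ be a tree of order $n\geq 3$ such that (1) for every end vertex $u$ there exists a $\gamma_t(T)$-set $D$ with $u\in D$; and (2) for every inner edge $uv$ there is a $\gamma_t(T)$-set $D$ such that (a) $|\{u,v\}\cap D|=1$, say $u\in D$, and $v\notin PN_T[u,D]$; or (b) $|\{u,v\}\cap D|=2$ and at least one of the following holds: (b1) $|N_T(u)\cap D|\geq 2$ and $|N_T(v)\cap D|\geq 2$; (b2) $N_T(u)\cap D=\{v\}$ and either $PN_T[u,D]=\emptyset$, or ($PN_T[v,D]=\emptyset$ and $|N_T(x)\cap D|\geq 2$ for every vertex $x\in (N_T(v)\cap D)\setminus\{u\}$); (b3) $N_T(v)\cap D=\{u\}$ and either $PN_T[v,D]=\emptyset$, or ($PN_T[u,D]=\emptyset$ and $|N_T(x)\cap D|\geq 2$ for every vertex $x\in (N_T(u)\cap D)\setminus\{v\}$). Then $\mathrm{sd}_{\gamma_t}(T)>1$.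
   Context: A set $S\subseteq V(G)$ is a total dominating set of $G$ if every vertex of $G$ is adjacent to a vertex of $S$; $\gamma_t(G)$ is the minimum size of such a set and a $\gamma_t(G)$-set is a total dominating set of that size. An end vertex is a vertex of degree 1; an inner edge is an edge not incident with an end vertex. $N_T(v)$ is the open neighbourhood and $N_T[v]=N_T(v)\cup\{v\}$; for $X\subseteq V$, $N_T[X]=\bigcup_{x\in X}N_T[x]$. For $u\in D\subseteq V(T)$, the private neighbourhood is $PN_T[u,D]=N_T[u]\setminus N_T[D\setminus\{u\}]$. $\mathrm{sd}_{\gamma_t}(G)$ is the minimum number of edges that must be subdivided (each edge at most once, i.e. replaced by a path of length 2 through a new vertex) to increase $\gamma_t$. -}

module Defs where

open import Data.Nat using (ℕ; zero; suc; _≤_; _+_)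
open import Data.Bool using (Bool; true; false; _∧_; _∨_; not)
open import Data.Fin using (Fin; zero; suc)
open import Data.Fin.Properties using (_≟_)
open import Data.Fin.Subset using (Subset; _∈_; _∉_; ∣_∣; _∩_; ⁅_⁆)
open import Data.Vec using (tabulate)
open import Data.List using (List; []; _∷_; _++_; length)
open import Data.List.Relation.Unary.Linked using (Linked)
open import Data.List.Relation.Unary.Unique.Propositional using (Unique)
open import Data.Product using (Σ; ∃; _×_; _,_)
open import Data.Sum using (_⊎_)
open import Relation.Nullary using (¬_; ⌊_⌋)
open import Relation.Binary.PropositionalEquality using (_≡_; _≢_)

Adjacency : ℕ → Set
Adjacency n = Fin n → Fin n → Bool

module _ {n : ℕ} (G : Adjacency n) where

  IsSimple : Set
  IsSimple = (∀ u v → G u v ≡ G v u) × (∀ v → G v v ≡ false)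

  Edge : Fin n → Fin n → Set
  Edge u v = G u v ≡ true

  data Walk : Fin n → Fin n → Set where
    here : ∀ {u} → Walk u u
    step : ∀ {u v w} → Edge u v → Walk v w → Walk u w

  Connected : Set
  Connected = ∀ u v → Walk u v

  -- a cycle: distinct vertices x, x1, ..., xk (k ≥ 2), consecutively adjacent,
  -- with xk adjacent to x
  HasCycle : Set
  HasCycle = Σ (Fin n) λ x → Σ (List (Fin n)) λ xs →
    (2 ≤ length xs) × Unique (x ∷ xs) × Linked Edge (x ∷ xs ++ (x ∷ []))

  IsTree : Set
  IsTree = Connected × ¬ HasCycle

  Nb : Fin n → Subset n
  Nb u = tabulate (G u)

  deg : Fin n → ℕ
  deg u = ∣ Nb u ∣

  EndVertex : Fin n → Set
  EndVertex u = deg u ≡ 1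

  InnerEdge : Fin n → Fin n → Set
  InnerEdge u v = Edge u v × deg u ≢ 1 × deg v ≢ 1

  IsTDS : Subset n → Set
  IsTDS S = ∀ v → ∃ λ u → u ∈ S × Edge u v

  IsγtSet : Subset n → Set
  IsγtSet D = IsTDS D × (∀ S → IsTDS S → ∣ D ∣ ≤ ∣ S ∣)

  InN[_] : Fin n → Fin n → Set
  InN[ w ] x = x ≡ w ⊎ Edge w x

  -- x ∈ PN[u,D] = N[u] \ N[D \ {u}]
  InPN : Fin n → Subset n → Fin n → Set
  InPN u D x = InN[ u ] x × (∀ w → w ∈ D → w ≢ u → ¬ InN[ w ] x)

  PNEmpty : Fin n → Subset n → Set
  PNEmpty u D = ∀ x → ¬ InPN u D x

  nbD : Subset n → Fin n → ℕ
  nbD D u = ∣ Nb u ∩ D ∣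

  CondA : Subset n → Fin n → Fin n → Set
  CondA D u v = u ∈ D × v ∉ D × ¬ InPN u D v

  CondB1 : Subset n → Fin n → Fin n → Set
  CondB1 D u v = 2 ≤ nbD D u × 2 ≤ nbD D v

  -- (b2); (b3) is CondB2 D v u
  CondB2 : Subset n → Fin n → Fin n → Set
  CondB2 D u v = (Nb u ∩ D ≡ ⁅ v ⁆) ×
    (PNEmpty u D ⊎
      (PNEmpty v D × (∀ x → x ∈ D → Edge v x → x ≢ u → 2 ≤ nbD D x)))

  CondB : Subset n → Fin n → Fin n → Set
  CondB D u v = u ∈ D × v ∈ D × (CondB1 D u v ⊎ CondB2 D u v ⊎ CondB2 D v u)

  EdgeCond : Subset n → Fin n → Fin n → Set
  EdgeCond D u v = CondA D u v ⊎ CondA D v u ⊎ CondB D u v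

-- subdivision of the edge uv: new vertex is zero, old vertex i becomes suc i
module _ {n : ℕ} where
  isEnd : Fin n → Fin n → Fin n → Bool
  isEnd u v i = ⌊ i ≟ u ⌋ ∨ ⌊ i ≟ v ⌋

  subAdj : Adjacency n → Fin n → Fin n → Adjacency (suc n)
  subAdj G u v zero zero = false
  subAdj G u v zero (suc j) = isEnd u v j
  subAdj G u v (suc i) zero = isEnd u v i
  subAdj G u v (suc i) (suc j) =
    G i j ∧ not ((⌊ i ≟ u ⌋ ∧ ⌊ j ≟ v ⌋) ∨ (⌊ i ≟ v ⌋ ∧ ⌊ j ≟ u ⌋))

-- Subdivide the edge uv by a new vertex s.  A total dominating set D of T becomes one
-- of the subdivided tree, no larger, in one of two ways: keep D (if u or v lies in D
-- and each of u, v has a D-neighbour other than the other), or trade a ∈ {u, v} for s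
-- (if the other end b lies in D and every vertex besides a, b has a D-neighbour other
-- than a).  For an end vertex u the γt-set containing u allows the trade, and for an
-- inner edge each of (a), (b1), (b2), (b3) provides exactly what one of the moves needs.
module Submission where

open import Defs
open import Data.Bool using (true; false; _∧_; _∨_; not)
import Data.Bool as Bool
open import Data.Bool.Properties using (∨-comm; ∨-zeroʳ)
open import Data.Fin using (Fin; zero; suc)
open import Data.Fin.Properties using (_≟_; any?)
open import Data.Fin.Subset
  using (Subset; inside; outside; _∈_; _∉_; _⊆_; ∣_∣; _∩_; _-_; ⁅_⁆)
open import Data.Fin.Subset.Properties
  using ( _∈?_; x∈⁅x⁆; x∈⁅y⁆⇒x≡y; x≢y⇒x∉⁅y⁆; ∣⁅x⁆∣≡1; p⊆q⇒∣p∣≤∣q∣; p⊂q⇒∣p∣<∣q∣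
        ; x∈p∩q⁺; x∈p∩q⁻; x∈p∧x≢y⇒x∈p-y; x∈p⇒∣p-x∣<∣p∣ )
open import Data.Nat using (ℕ; suc; _≤_; _<_)
import Data.Nat.Properties as ℕₚ
open import Data.Product using (∃; _×_; _,_; proj₁; proj₂)
open import Data.Sum using (_⊎_; inj₁; inj₂; [_,_]′)
open import Data.Vec.Base using (_∷_; here; there)
open import Data.Vec.Properties using (lookup∘tabulate; lookup⇒[]=; []=⇒lookup)
open import Function using (_∘_)
open import Relation.Nullary using (¬_; yes; no; ⌊_⌋; contradiction)
open import Relation.Nullary.Decidable using (_⊎-dec_; _×-dec_; ¬?; dec-true; isYes≗does)
open import Relation.Binary.PropositionalEquality
  using (_≡_; _≢_; refl; sym; trans; cong; subst; subst₂)

module _ {n : ℕ} where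

  ⁅x⁆⊆p : ∀ {x : Fin n} {p} → x ∈ p → ⁅ x ⁆ ⊆ p
  ⁅x⁆⊆p {x} x∈p y∈⁅x⁆ = subst (_∈ _) (sym (x∈⁅y⁆⇒x≡y x y∈⁅x⁆)) x∈p

  ∣p∣≡1⇒x≡y : ∀ {p : Subset n} {x y} → ∣ p ∣ ≡ 1 → x ∈ p → y ∈ p → x ≡ y
  ∣p∣≡1⇒x≡y {p} {x} {y} ∣p∣≡1 x∈p y∈p with y ≟ x
  ... | yes y≡x = sym y≡x
  ... | no y≢x = contradiction 1<1 (ℕₚ.n≮n 1)
    where
    1<1 : 1 < 1
    1<1 = subst₂ _<_ (∣⁅x⁆∣≡1 x) ∣p∣≡1
      (p⊂q⇒∣p∣<∣q∣ (⁅x⁆⊆p x∈p , y , y∈p , x≢y⇒x∉⁅y⁆ y≢x))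

  2≤∣p∣⇒∃≢ : ∀ (p : Subset n) y → 2 ≤ ∣ p ∣ → ∃ λ x → x ∈ p × x ≢ y
  2≤∣p∣⇒∃≢ p y 2≤∣p∣ with any? (λ x → x ∈? p ×-dec ¬? (x ≟ y))
  ... | yes found = found
  ... | no none = contradiction (ℕₚ.≤-trans 2≤∣p∣ ∣p∣≤1) (ℕₚ.n≮n 1)
    where
    p⊆⁅y⁆ : p ⊆ ⁅ y ⁆
    p⊆⁅y⁆ {x} x∈p with x ≟ y
    ... | yes refl = x∈⁅x⁆ y
    ... | no x≢y = contradiction (x , x∈p , x≢y) none

    ∣p∣≤1 : ∣ p ∣ ≤ 1
    ∣p∣≤1 = subst (∣ p ∣ ≤_) (∣⁅x⁆∣≡1 y) (p⊆q⇒∣p∣≤∣q∣ p⊆⁅y⁆)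

  ⌊x≟x⌋ : ∀ (x : Fin n) → ⌊ x ≟ x ⌋ ≡ true
  ⌊x≟x⌋ x = trans (isYes≗does (x ≟ x)) (dec-true (x ≟ x) refl)

  ∧-≟-false : ∀ {a b c d : Fin n} → ¬ (a ≡ c × b ≡ d) → ⌊ a ≟ c ⌋ ∧ ⌊ b ≟ d ⌋ ≡ false
  ∧-≟-false {a} {b} {c} {d} ¬eq with a ≟ c | b ≟ d
  ... | yes a≡c | yes b≡d = contradiction (a≡c , b≡d) ¬eq
  ... | yes _   | no _    = refl
  ... | no _    | _       = refl

HasTDS≤ : ∀ {n} → Adjacency n → ℕ → Set
HasTDS≤ G k = ∃ λ S → IsTDS G S × ∣ S ∣ ≤ k

HasTDS≤-weaken : ∀ {n} {G : Adjacency n} {k l} → k ≤ l → HasTDS≤ G k → HasTDS≤ G l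
HasTDS≤-weaken k≤l (S , S-tds , ∣S∣≤k) = S , S-tds , ℕₚ.≤-trans ∣S∣≤k k≤l

module _ {n : ℕ} (T : Adjacency n) where

  DominatedAvoiding : Subset n → Fin n → Fin n → Set
  DominatedAvoiding D a y = ∃ λ w → w ∈ D × w ≢ a × Edge T w y

  edge⇒∈Nb : ∀ {a y} → Edge T a y → y ∈ Nb T a
  edge⇒∈Nb {a} {y} e = lookup⇒[]= y (Nb T a) (trans (lookup∘tabulate (T a) y) e)

  ∈Nb⇒edge : ∀ {a y} → y ∈ Nb T a → Edge T a y
  ∈Nb⇒edge {a} {y} y∈Nb = trans (sym (lookup∘tabulate (T a) y)) ([]=⇒lookup y∈Nb)

  subAdj-comm : ∀ u v a b → subAdj T u v a b ≡ subAdj T v u a b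
  subAdj-comm u v zero    zero    = refl
  subAdj-comm u v zero    (suc j) = ∨-comm ⌊ j ≟ u ⌋ ⌊ j ≟ v ⌋
  subAdj-comm u v (suc i) zero    = ∨-comm ⌊ i ≟ u ⌋ ⌊ i ≟ v ⌋
  subAdj-comm u v (suc i) (suc j) =
    cong (λ b → T i j ∧ not b) (∨-comm (⌊ i ≟ u ⌋ ∧ ⌊ j ≟ v ⌋) (⌊ i ≟ v ⌋ ∧ ⌊ j ≟ u ⌋))

  HasTDS≤-subAdj-comm : ∀ {u v k} → HasTDS≤ (subAdj T v u) k → HasTDS≤ (subAdj T u v) k
  HasTDS≤-subAdj-comm {u} {v} (S , S-tds , ∣S∣≤k) = S , tds , ∣S∣≤k
    where
    tds : IsTDS (subAdj T u v) S
    tds y = let (w , w∈S , e) = S-tds y in w , w∈S , trans (subAdj-comm u v w y) e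

  module Subdivision (u v : Fin n) (u≢v : u ≢ v) where

    T' : Adjacency (suc n)
    T' = subAdj T u v

    edge-u-mid : Edge T' (suc u) zero
    edge-u-mid = cong (_∨ ⌊ u ≟ v ⌋) (⌊x≟x⌋ u)

    edge-v-mid : Edge T' (suc v) zero
    edge-v-mid = trans (cong (⌊ v ≟ u ⌋ ∨_) (⌊x≟x⌋ v)) (∨-zeroʳ ⌊ v ≟ u ⌋)

    edge-mid-u : Edge T' zero (suc u)
    edge-mid-u = edge-u-mid

    edge-mid-v : Edge T' zero (suc v)
    edge-mid-v = edge-v-mid

    edge-old : ∀ {a b} → Edge T a b → ¬ (a ≡ u × b ≡ v) → ¬ (a ≡ v × b ≡ u) →
               Edge T' (suc a) (suc b)
    edge-old e ¬uv ¬vu rewrite e | ∧-≟-false ¬uv | ∧-≟-false ¬vu = refl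

    keep : ∀ {D} → IsTDS T D → u ∈ D ⊎ v ∈ D →
      DominatedAvoiding D v u → DominatedAvoiding D u v → HasTDS≤ T' ∣ D ∣
    keep {D} D-tds u∈D⊎v∈D (wu , wu∈D , wu≢v , wu∼u) (wv , wv∈D , wv≢u , wv∼v) =
      outside ∷ D , tds , ℕₚ.≤-refl
      where
      tds : IsTDS T' (outside ∷ D)
      tds zero = [ (λ u∈D → suc u , there u∈D , edge-u-mid)
                 , (λ v∈D → suc v , there v∈D , edge-v-mid) ]′ u∈D⊎v∈D
      tds (suc y) with y ≟ u | y ≟ v
      ... | yes refl | _        =
        suc wu , there wu∈D , edge-old wu∼u (u≢v ∘ proj₂) (wu≢v ∘ proj₁)
      ... | no _     | yes refl =
        suc wv , there wv∈D , edge-old wv∼v (wv≢u ∘ proj₁) (u≢v ∘ sym ∘ proj₂)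
      ... | no y≢u   | no y≢v   =
        let (w , w∈D , w∼y) = D-tds y in
        suc w , there w∈D , edge-old w∼y (y≢v ∘ proj₂) (y≢u ∘ proj₂)

    trade : ∀ {D} → u ∈ D → v ∈ D →
      (∀ y → y ≢ u → y ≢ v → DominatedAvoiding D u y) → HasTDS≤ T' ∣ D ∣
    trade {D} u∈D v∈D avoid-u = inside ∷ (D - u) , tds , x∈p⇒∣p-x∣<∣p∣ u∈D
      where
      tds : IsTDS T' (inside ∷ (D - u))
      tds zero = suc v , there (x∈p∧x≢y⇒x∈p-y v∈D (u≢v ∘ sym)) , edge-v-mid
      tds (suc y) with y ≟ u | y ≟ v
      ... | yes refl | _        = zero , here , edge-mid-u
      ... | no _     | yes refl = zero , here , edge-mid-v
      ... | no y≢u   | no y≢v   =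
        let (w , w∈D , w≢u , w∼y) = avoid-u y y≢u y≢v in
        suc w , there (x∈p∧x≢y⇒x∈p-y w∈D w≢u) , edge-old w∼y (y≢v ∘ proj₂) (y≢u ∘ proj₂)

module _ {n : ℕ} {T : Adjacency n} (simple : IsSimple T) where

  Edge-sym : ∀ {a b} → Edge T a b → Edge T b a
  Edge-sym {a} {b} e = trans (proj₁ simple b a) e

  Edge-irrefl : ∀ {a b} → Edge T a b → a ≢ b
  Edge-irrefl {a} e refl = contradiction (trans (sym e) (proj₂ simple a)) λ ()

  end-neighbour-unique : ∀ {a y z} → EndVertex T a → Edge T a y → Edge T a z → y ≡ z
  end-neighbour-unique a-end a∼y a∼z = ∣p∣≡1⇒x≡y a-end (edge⇒∈Nb T a∼y) (edge⇒∈Nb T a∼z)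

  Nb∩D≡⁅b⁆⇒≡ : ∀ {D a b y} → Nb T a ∩ D ≡ ⁅ b ⁆ → y ∈ D → Edge T a y → y ≡ b
  Nb∩D≡⁅b⁆⇒≡ {b = b} {y} eq y∈D a∼y =
    x∈⁅y⁆⇒x≡y b (subst (y ∈_) eq (x∈p∩q⁺ (edge⇒∈Nb T a∼y , y∈D)))

  2≤nbD⇒avoiding : ∀ {D a} b → 2 ≤ nbD T D a → DominatedAvoiding T D b a
  2≤nbD⇒avoiding {D} {a} b 2≤nbD with 2≤∣p∣⇒∃≢ (Nb T a ∩ D) b 2≤nbD
  ... | w , w∈Nb∩D , w≢b =
    let (w∈Nb , w∈D) = x∈p∩q⁻ (Nb T a) D w∈Nb∩D in
    w , w∈D , w≢b , Edge-sym (∈Nb⇒edge T w∈Nb)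

  ∉⇒avoiding : ∀ {D b} → IsTDS T D → b ∉ D → ∀ y → DominatedAvoiding T D b y
  ∉⇒avoiding D-tds b∉D y =
    let (w , w∈D , w∼y) = D-tds y in w , w∈D , (λ { refl → b∉D w∈D }) , w∼y

  not-private : ∀ {D a x} → InN[_] T a x → ¬ InPN T a D x →
    ∃ λ w → w ∈ D × w ≢ a × InN[_] T w x
  not-private {D} {a} {x} x∈N[a] x∉PN
    with any? (λ w → w ∈? D ×-dec ¬? (w ≟ a) ×-dec ((x ≟ w) ⊎-dec (T w x Bool.≟ true)))
  ... | yes found = found
  ... | no none = contradiction (x∈N[a] , λ w w∈D w≢a x∈N[w] → none (w , w∈D , w≢a , x∈N[w])) x∉PN

  -- Without private neighbours of a, a's role as dominator of y passes to another
  -- vertex of D, except when that vertex is y itself (the last hypothesis).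
  PNEmpty⇒avoiding : ∀ {D a} → IsTDS T D → PNEmpty T a D → ∀ y →
    (y ∈ D → Edge T a y → DominatedAvoiding T D a y) → DominatedAvoiding T D a y
  PNEmpty⇒avoiding {D} {a} D-tds a-PN y y∈D⇒avoiding with D-tds y
  ... | z , z∈D , z∼y with z ≟ a
  ... | no z≢a = z , z∈D , z≢a , z∼y
  ... | yes refl with not-private (inj₂ z∼y) (a-PN y)
  ... | w , w∈D , w≢a , inj₂ w∼y  = w , w∈D , w≢a , w∼y
  ... | w , w∈D , w≢a , inj₁ refl = y∈D⇒avoiding w∈D z∼y

  end-vertex⇒HasTDS≤ : ∀ {D a b} → IsTDS T D → a ∈ D → EndVertex T a → Edge T a b →
    HasTDS≤ (subAdj T a b) ∣ D ∣
  end-vertex⇒HasTDS≤ {D} {a} {b} D-tds a∈D a-end a∼b =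
    Subdivision.trade T a b (Edge-irrefl a∼b) a∈D b∈D avoid-a
    where
    b∈D : b ∈ D
    b∈D = let (z , z∈D , z∼a) = D-tds a in
      subst (_∈ D) (end-neighbour-unique a-end (Edge-sym z∼a) a∼b) z∈D

    avoid-a : ∀ y → y ≢ a → y ≢ b → DominatedAvoiding T D a y
    avoid-a y _ y≢b with D-tds y
    ... | z , z∈D , z∼y with z ≟ a
    ... | yes refl = contradiction (end-neighbour-unique a-end z∼y a∼b) y≢b
    ... | no z≢a   = z , z∈D , z≢a , z∼y

  CondA⇒HasTDS≤ : ∀ {D a b} → IsTDS T D → Edge T a b → CondA T D a b →
    HasTDS≤ (subAdj T a b) ∣ D ∣
  CondA⇒HasTDS≤ {D} {a} {b} D-tds a∼b (a∈D , b∉D , b∉PN) =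
    Subdivision.keep T a b (Edge-irrefl a∼b) D-tds (inj₁ a∈D)
      (∉⇒avoiding D-tds b∉D a) avoid-a
    where
    avoid-a : DominatedAvoiding T D a b
    avoid-a with not-private (inj₂ a∼b) b∉PN
    ... | w , w∈D , w≢a , inj₂ w∼b  = w , w∈D , w≢a , w∼b
    ... | w , w∈D , w≢a , inj₁ refl = contradiction w∈D b∉D

  CondB1⇒HasTDS≤ : ∀ {D a b} → IsTDS T D → Edge T a b → a ∈ D → CondB1 T D a b →
    HasTDS≤ (subAdj T a b) ∣ D ∣
  CondB1⇒HasTDS≤ {b = b} D-tds a∼b a∈D (2≤nbD-a , 2≤nbD-b) =
    Subdivision.keep T _ b (Edge-irrefl a∼b) D-tds (inj₁ a∈D)
      (2≤nbD⇒avoiding b 2≤nbD-a) (2≤nbD⇒avoiding _ 2≤nbD-b)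

  CondB2⇒HasTDS≤ : ∀ {D a b} → IsTDS T D → Edge T a b → a ∈ D → b ∈ D →
    CondB2 T D a b → HasTDS≤ (subAdj T a b) ∣ D ∣
  CondB2⇒HasTDS≤ {a = a} {b} D-tds a∼b a∈D b∈D (Nb∩D≡⁅b⁆ , inj₁ a-PN) =
    Subdivision.trade T a b (Edge-irrefl a∼b) a∈D b∈D λ y _ y≢b →
      PNEmpty⇒avoiding D-tds a-PN y λ y∈D a∼y → contradiction (Nb∩D≡⁅b⁆⇒≡ Nb∩D≡⁅b⁆ y∈D a∼y) y≢b
  CondB2⇒HasTDS≤ {a = a} {b} D-tds a∼b a∈D b∈D (_ , inj₂ (b-PN , 2≤nbD)) =
    HasTDS≤-subAdj-comm T (Subdivision.trade T b a (Edge-irrefl (Edge-sym a∼b)) b∈D a∈D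
      λ y _ y≢a → PNEmpty⇒avoiding D-tds b-PN y λ y∈D b∼y →
        2≤nbD⇒avoiding b (2≤nbD y y∈D b∼y y≢a))

  EdgeCond⇒HasTDS≤ : ∀ {D u v} → IsTDS T D → Edge T u v → EdgeCond T D u v →
    HasTDS≤ (subAdj T u v) ∣ D ∣
  EdgeCond⇒HasTDS≤ D-tds u∼v (inj₁ a) = CondA⇒HasTDS≤ D-tds u∼v a
  EdgeCond⇒HasTDS≤ D-tds u∼v (inj₂ (inj₁ a)) =
    HasTDS≤-subAdj-comm _ (CondA⇒HasTDS≤ D-tds (Edge-sym u∼v) a)
  EdgeCond⇒HasTDS≤ D-tds u∼v (inj₂ (inj₂ (u∈D , _ , inj₁ b1))) =
    CondB1⇒HasTDS≤ D-tds u∼v u∈D b1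
  EdgeCond⇒HasTDS≤ D-tds u∼v (inj₂ (inj₂ (u∈D , v∈D , inj₂ (inj₁ b2)))) =
    CondB2⇒HasTDS≤ D-tds u∼v u∈D v∈D b2
  EdgeCond⇒HasTDS≤ D-tds u∼v (inj₂ (inj₂ (u∈D , v∈D , inj₂ (inj₂ b3)))) =
    HasTDS≤-subAdj-comm _ (CondB2⇒HasTDS≤ D-tds (Edge-sym u∼v) v∈D u∈D b3)

lemma17 : (n : ℕ) (T : Adjacency n) → IsSimple T → IsTree T → 3 ≤ n →
    (∀ u → EndVertex T u → ∃ λ D → IsγtSet T D × u ∈ D) →
    (∀ u v → InnerEdge T u v → ∃ λ D → IsγtSet T D × EdgeCond T D u v) →
    ∀ u v → Edge T u v → ∀ D → IsγtSet T D →
      ∃ λ S → IsTDS (subAdj T u v) S × ∣ S ∣ ≤ ∣ D ∣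
lemma17 n T simple _ _ end-sets inner-sets u v u∼v D (D-tds , _)
  with deg T u ℕₚ.≟ 1 | deg T v ℕₚ.≟ 1
... | yes u-end | _ =
  let (D' , (D'-tds , D'-min) , u∈D') = end-sets u u-end in
  HasTDS≤-weaken (D'-min D D-tds) (end-vertex⇒HasTDS≤ simple D'-tds u∈D' u-end u∼v)
... | no _ | yes v-end =
  let (D' , (D'-tds , D'-min) , v∈D') = end-sets v v-end in
  HasTDS≤-weaken (D'-min D D-tds) (HasTDS≤-subAdj-comm T
    (end-vertex⇒HasTDS≤ simple D'-tds v∈D' v-end (Edge-sym simple u∼v)))
... | no u-inner | no v-inner =
  let (D' , (D'-tds , D'-min) , cond) = inner-sets u v (u∼v , u-inner , v-inner) in
  HasTDS≤-weaken (D'-min D D-tds) (EdgeCond⇒HasTDS≤ simple D'-tds u∼v cond)
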